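{- Let $\mathcal S=(n,I,J,K,\psi,\pi)$ and $\mathcal S'=(n,I',J',K',\psi',\pi')$ be systems with the same $n$, with associated functions $\theta$ and $\theta'$, and let $(y_i)_{i=0}^n$ and $(y'_i)_{i=0}^n$ be the sequences generated by $\mathcal S$ and $\mathcal S'$ respectively. Let $2\le\ell\le n$ and assume: (1) for every $2\le i\le n$, $\theta(i)\ge\ell-1$ implies $\theta'(i)=\theta(i)$; (2) $y'_{\ell-1}\ge y_{\ell-1}$ and $y'_\ell\ge y_\ell$; (3) $y'_{\theta'(i)}\ge y_{\theta(i)}$ for all $i$ with $\ell<i\le n$ and $\theta(i)<\ell-1$. Then $y'_i\ge y_i$ for all $\ell-1\le i\le n$; in particular $y'_n\ge y_n$, i.e. $\mathcal S'$ improves $\mathcal S$.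
   Context: A system is a tuple $\mathcal S=(n,I,J,K,\psi,\pi)$ where $n\ge2$ is an integer, $I,J,K$ are pairwise disjoint subsets of $\{2,\dots,n\}$ with $|I|=|J|\ge|K|$, $\psi:I\to J$ is a bijection, $\pi:I\to K$ is a surjection, and $i<\pi(i)<\psi(i)$ for all $i\in I$. Indices in $I$, $J$, $K$ are called exceptional, penalty and fine; other indices of $\{2,\dots,n\}$ are ordinary. For $k\in K$ put $d(k)=\min\pi^{ -1}(k)$. For $2\le r\le n$, $\theta(r)=r-2$ if $r$ is ordinary, $r-1$ if exceptional, $\psi^{ -1}(r)-1$ if penalty, $d(r)-2$ if fine. The sequence generated by $\mathcal S$ is $(y_i)_{i=0}^n$ with $y_0=1$, $y_1=2$, $y_r=y_{r-1}+y_{\theta(r)}$ ($2\le r\le n$). A system $\mathcal S'$ with the same $n$ improves $\mathcal S$ if the last terms of their generated sequences satisfy $y'_n\ge y_n$. -}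

module Defs where

open import Data.Nat using (ℕ; zero; suc; _+_; _∸_; _≤_; _<_; _≡ᵇ_; _≤ᵇ_)
open import Data.Bool using (Bool; true; false; if_then_else_; _∧_)
open import Data.Product using (_×_; ∃)
open import Relation.Binary.PropositionalEquality using (_≡_)
open import Relation.Nullary using (¬_)

-- Subsets of ℕ are given by Boolean membership functions.
-- count p n = #{ i ≤ n | p i = true }
count : (ℕ → Bool) → ℕ → ℕ
count p zero    = if p zero then 1 else 0
count p (suc n) = (if p (suc n) then 1 else 0) + count p n

least : (ℕ → Bool) → ℕ → ℕ
least p zero    = zero
least p (suc n) = if p zero then zero else suc (least (λ i → p (suc i)) n)

-- A system S = (n, I, J, K, ψ, π).  ψ and π are total functions on ℕ,
-- of which only the restrictions to I matter.
record System (n : ℕ) : Set where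
  field
    2≤n   : 2 ≤ n
    I J K : ℕ → Bool
    ψ π   : ℕ → ℕ
    I-range : ∀ i → I i ≡ true → 2 ≤ i × i ≤ n
    J-range : ∀ i → J i ≡ true → 2 ≤ i × i ≤ n
    K-range : ∀ i → K i ≡ true → 2 ≤ i × i ≤ n
    IJ-disj : ∀ i → ¬ (I i ≡ true × J i ≡ true)
    IK-disj : ∀ i → ¬ (I i ≡ true × K i ≡ true)
    JK-disj : ∀ i → ¬ (J i ≡ true × K i ≡ true)
    card-IJ : count I n ≡ count J n
    card-JK : count K n ≤ count J n
    ψ-maps : ∀ i → I i ≡ true → J (ψ i) ≡ true
    ψ-inj  : ∀ i i′ → I i ≡ true → I i′ ≡ true → ψ i ≡ ψ i′ → i ≡ i′
    ψ-surj : ∀ j → J j ≡ true → ∃ λ i → I i ≡ true × ψ i ≡ j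
    π-maps : ∀ i → I i ≡ true → K (π i) ≡ true
    π-surj : ∀ k → K k ≡ true → ∃ λ i → I i ≡ true × π i ≡ k
    order  : ∀ i → I i ≡ true → i < π i × π i < ψ i

module _ {n : ℕ} (S : System n) where
  open System S

  -- ψ⁻¹(j) for j ∈ J (the unique, hence least, i ∈ I with ψ i = j)
  ψinv : ℕ → ℕ
  ψinv j = least (λ i → I i ∧ (ψ i ≡ᵇ j)) n

  d : ℕ → ℕ
  d k = least (λ i → I i ∧ (π i ≡ᵇ k)) n

  θ : ℕ → ℕ
  θ r = if I r then r ∸ 1
        else if J r then ψinv r ∸ 1
        else if K r then d r ∸ 2
        else r ∸ 2

  -- table m i = y_i for all i ≤ m (uses θ r < r for 2 ≤ r ≤ n)
  table : ℕ → ℕ → ℕ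
  table zero          _ = 1
  table (suc zero)    i = if i ≡ᵇ 0 then 1 else 2
  table (suc (suc m)) i =
    if i ≤ᵇ suc m then table (suc m) i
    else table (suc m) (suc m) + table (suc m) (θ (suc (suc m)))

  -- the sequence generated by S: y 0 = 1, y 1 = 2, y r = y (r-1) + y (θ r)
  y : ℕ → ℕ
  y r = table r r

-- For r > ℓ both sequences satisfy y r = y (r - 1) + y (θ r) with r - 1 and
-- θ r below r, so y ≤ y′ propagates upwards by strong induction from ℓ - 1
-- and ℓ.  The summand y (r - 1) is covered inductively, and so is y (θ r)
-- when θ r ≥ ℓ - 1, because then θ′ r = θ r; when θ r < ℓ - 1 the comparison
-- is hypothesis (3).
module Submission where

open import Defs
open import Data.Nat using (ℕ; zero; suc; _+_; _∸_; _≤_; _<_; z≤n; s≤s; _≡ᵇ_; _≤ᵇ_)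
open import Data.Nat.Properties
open import Data.Nat.Induction using (<-rec)
open import Data.Bool using (Bool; true; false; _∧_)
open import Data.Bool.Properties using (T-≡)
open import Data.Product using (_×_; _,_; proj₁; proj₂)
open import Data.Sum using (inj₁; inj₂)
open import Function.Bundles using (Equivalence)
open import Relation.Binary.Definitions using (tri<; tri≈; tri>)
open import Relation.Binary.PropositionalEquality using (_≡_; refl; sym; trans; cong; subst)
open import Relation.Nullary using (yes; no)

least-minimal : ∀ (p : ℕ → Bool) n {i} → p i ≡ true → least p n ≤ i
least-minimal p zero    _ = z≤n
least-minimal p (suc n) {zero} pi rewrite pi = z≤n
least-minimal p (suc n) {suc i} pi with p zero
... | true  = z≤n
... | false = s≤s (least-minimal (λ j → p (suc j)) n pi)

≡ᵇ-refl : ∀ m → (m ≡ᵇ m) ≡ true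
≡ᵇ-refl zero    = refl
≡ᵇ-refl (suc m) = ≡ᵇ-refl m

least-matching-≤ : ∀ n (p : ℕ → Bool) (f : ℕ → ℕ) {i} → p i ≡ true →
                   least (λ j → p j ∧ (f j ≡ᵇ f i)) n ≤ i
least-matching-≤ n p f {i} pi =
  least-minimal _ n (subst (λ b → b ∧ (f i ≡ᵇ f i) ≡ true) (sym pi) (≡ᵇ-refl (f i)))

1+n≰ᵇn : ∀ m → (suc m ≤ᵇ m) ≡ false
1+n≰ᵇn zero    = refl
1+n≰ᵇn (suc m) = 1+n≰ᵇn m

module _ {n : ℕ} (S : System n) where
  open System S

  table-suc : ∀ m {i} → i ≤ m → table S (suc m) i ≡ table S m i
  table-suc zero    z≤n = refl
  table-suc (suc m) i≤m rewrite Equivalence.to T-≡ (≤⇒≤ᵇ i≤m) = refl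

  table-stable : ∀ m {i} → i ≤ m → table S m i ≡ y S i
  table-stable zero    z≤n = refl
  table-stable (suc m) i≤1+m with m≤n⇒m<n∨m≡n i≤1+m
  ... | inj₂ refl      = refl
  ... | inj₁ (s≤s i≤m) = trans (table-suc m i≤m) (table-stable m i≤m)

  ψinv-< : ∀ {i j} → I i ≡ true → ψ i ≡ j → ψinv S j < j
  ψinv-< {i} Ii refl =
    ≤-<-trans (least-matching-≤ n I ψ Ii) (<-trans (proj₁ (order i Ii)) (proj₂ (order i Ii)))

  d-< : ∀ {i k} → I i ≡ true → π i ≡ k → d S k < k
  d-< {i} Ii refl = ≤-<-trans (least-matching-≤ n I π Ii) (proj₁ (order i Ii))

  θ-< : ∀ m → θ S (suc (suc m)) < suc (suc m)
  θ-< m with I (suc (suc m))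
  ... | true = n<1+n (suc m)
  ... | false with J (suc (suc m)) in eJ
  ...   | true with ψ-surj _ eJ
  ...     | _ , Ii , ψi≡r = ≤-<-trans (m∸n≤m _ 1) (ψinv-< Ii ψi≡r)
  θ-< m | false | false with K (suc (suc m)) in eK
  ...     | true with π-surj _ eK
  ...       | _ , Ii , πi≡r = ≤-<-trans (m∸n≤m _ 2) (d-< Ii πi≡r)
  θ-< m | false | false | false = m<n⇒m<1+n (n<1+n m)

  y-suc : ∀ m → y S (suc (suc m)) ≡ y S (suc m) + y S (θ S (suc (suc m)))
  y-suc m rewrite 1+n≰ᵇn (suc m) =
    cong (y S (suc m) +_) (table-stable (suc m) (≤-pred (θ-< m)))

y-dominates : ∀ {n} (S S′ : System n) k →
              (∀ i → 2 ≤ i → i ≤ n → k ≤ θ S i → θ S′ i ≡ θ S i) →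
              y S k ≤ y S′ k → y S (suc k) ≤ y S′ (suc k) →
              (∀ i → suc k < i → i ≤ n → θ S i < k → y S (θ S i) ≤ y S′ (θ S′ i)) →
              ∀ i → k ≤ i → i ≤ n → y S i ≤ y S′ i
y-dominates {n} S S′ k θ-agree y-k y-1+k y-θ-low =
  <-rec (λ i → k ≤ i → i ≤ n → y S i ≤ y S′ i) step
  where
  step : ∀ i → (∀ {j} → j < i → k ≤ j → j ≤ n → y S j ≤ y S′ j) →
         k ≤ i → i ≤ n → y S i ≤ y S′ i
  step i ih k≤i i≤n with <-cmp i (suc k)
  ... | tri< i<1+k _ _ = subst (λ j → y S j ≤ y S′ j) (≤-antisym k≤i (≤-pred i<1+k)) y-k
  ... | tri≈ _ refl _  = y-1+k
  step (suc (suc m)) ih k≤i i≤n | tri> _ _ 1+k<i@(s≤s k<1+m) = begin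
    y S (suc (suc m))                         ≡⟨ y-suc S m ⟩
    y S (suc m) + y S (θ S (suc (suc m)))     ≤⟨ +-mono-≤ (ih ≤-refl (<⇒≤ k<1+m) m+1≤n) θ-term ⟩
    y S′ (suc m) + y S′ (θ S′ (suc (suc m)))  ≡⟨ sym (y-suc S′ m) ⟩
    y S′ (suc (suc m))                        ∎
    where
    open ≤-Reasoning
    m+1≤n : suc m ≤ n
    m+1≤n = ≤-trans (n≤1+n _) i≤n
    θ-term : y S (θ S (suc (suc m))) ≤ y S′ (θ S′ (suc (suc m)))
    θ-term with θ S (suc (suc m)) <? k
    ... | yes θ<k = y-θ-low _ 1+k<i i≤n θ<k
    ... | no θ≮k rewrite θ-agree _ (s≤s (s≤s z≤n)) i≤n (≮⇒≥ θ≮k) =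
      ih (θ-< S m) (≮⇒≥ θ≮k) (≤-trans (<⇒≤ (θ-< S m)) i≤n)

lemma4p5 : (n : ℕ) (S S′ : System n) (ℓ : ℕ) → 2 ≤ ℓ → ℓ ≤ n →
           (∀ i → 2 ≤ i → i ≤ n → ℓ ∸ 1 ≤ θ S i → θ S′ i ≡ θ S i) →
           y S (ℓ ∸ 1) ≤ y S′ (ℓ ∸ 1) → y S ℓ ≤ y S′ ℓ →
           (∀ i → ℓ < i → i ≤ n → θ S i < ℓ ∸ 1 → y S (θ S i) ≤ y S′ (θ S′ i)) →
           (∀ i → ℓ ∸ 1 ≤ i → i ≤ n → y S i ≤ y S′ i) × (y S n ≤ y S′ n)
lemma4p5 n S S′ (suc k) _ ℓ≤n θ-agree y-k y-1+k y-θ-low =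
  dominates , dominates n (≤-trans (n≤1+n k) ℓ≤n) ≤-refl
  where
  dominates : ∀ i → k ≤ i → i ≤ n → y S i ≤ y S′ i
  dominates = y-dominates S S′ k θ-agree y-k y-1+k y-θ-low
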